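{- For every integer $n \geq 2$, the smallest positive integer $k$ for which there exists a map $f: E(H_n) \to \{1,2,\dots,k\}$ (not necessarily a proper edge coloring) such that all vertices of $H_n$ are distinguished by $f$ is $k = 2$.
   Context: The $n$-dimensional hypercube $H_n$ is the graph whose vertices are the binary sequences of length $n$, two vertices being adjacent if the sequences differ in exactly one position; if they differ in position $i$, the edge is said to be of dimension $i$. For a vertex $x$ of $H_n$, let $e_i(x)$ denote the unique edge of dimension $i$ incident to $x$. For an edge coloring $f: E(H_n) \to \{1,\dots,k\}$, the palette at $x$ is the sequence $F(x) = (f(e_1(x)), f(e_2(x)), \dots, f(e_n(x)))$. Two vertices are distinguished by $f$ if their palettes are different sequences; all vertices are distinguished by $f$ if the palettes of any two distinct vertices differ. -}

module Defs where

open import Data.Nat using (ℕ; _≤_)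
open import Data.Bool using (Bool; not)
open import Data.Fin using (Fin)
open import Data.Vec using (Vec; tabulate; lookup; updateAt)
open import Data.Product using (Σ; _×_)
open import Relation.Binary.PropositionalEquality using (_≡_)

Vertex : ℕ → Set
Vertex n = Vec Bool n

-- The neighbour of x across dimension i (flip the i-th coordinate).
-- The edge e_i(x) is {x , flip i x}.
flip : ∀ {n} → Fin n → Vertex n → Vertex n
flip i x = updateAt x i not

-- An edge colouring f : E(H_n) → {1,…,k}, encoded by the colour it assigns
-- to e_i(x) for every vertex x and dimension i; since e_i(x) = e_i(flip i x),
-- the two endpoints must see the same colour.
record EdgeColouring (n k : ℕ) : Set where
  field
    colour     : Vertex n → Fin n → Fin k
    consistent : ∀ x i → colour x i ≡ colour (flip i x) i
open EdgeColouring public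

palette : ∀ {n k} → EdgeColouring n k → Vertex n → Vec (Fin k) n
palette f x = tabulate (λ i → colour f x i)

AllDistinguished : ∀ {n k} → EdgeColouring n k → Set
AllDistinguished {n} f = ∀ (x y : Vertex n) → palette f x ≡ palette f y → x ≡ y

Distinguishable : ℕ → ℕ → Set
Distinguishable n k = Σ (EdgeColouring n k) AllDistinguished

IsLeastPositive : (ℕ → Set) → ℕ → Set
IsLeastPositive P k = (1 ≤ k) × P k × (∀ m → 1 ≤ m → P m → k ≤ m)

{-# OPTIONS --safe #-}
-- Colour the edge e_i(x) by the coordinate x_σ(i), where σ is a fixed-point-free
-- permutation of the dimensions.  Flipping coordinate i does not change x_σ(i), so
-- both endpoints agree on the colour; and since σ is onto, the palette of x lists
-- every coordinate of x, hence determines x.  With a single colour all palettes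
-- coincide, so one colour never suffices.
module Submission where

open import Defs
open import Data.Nat using (ℕ; zero; suc; _≤_; z≤n; s≤s)
import Data.Nat as ℕ
open import Data.Bool using (Bool; true; false)
open import Data.Fin using (Fin; zero; suc; fromℕ; inject₁; lower₁; toℕ)
open import Data.Fin.Properties
  using (2↔Bool; <⇒≢; ≤̄⇒inject₁<; toℕ-injective; toℕ-fromℕ; inject₁-lower₁)
import Data.Fin.Properties as Fin
open import Data.Vec using (_∷_; lookup; replicate)
open import Data.Vec.Properties using (lookup∘updateAt′; lookup∘tabulate; tabulate-cong)
open import Data.Vec.Relation.Binary.Pointwise.Extensional using (ext; Pointwise-≡⇒≡)
open import Data.Product using (∃; _,_)
open import Function using (_↣_; Injection)
open import Function.Properties.Inverse using (↔-sym; ↔⇒↣)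
open import Relation.Nullary using (¬_; yes; no; contradiction)
open import Relation.Binary.PropositionalEquality

open Injection using (to; injective)

module _ {n k : ℕ} (ι : Bool ↣ Fin k) (σ : Fin n → Fin n) (σ-fixedPointFree : ∀ i → σ i ≢ i) where

  coordinateColouring : EdgeColouring n k
  coordinateColouring .colour x i = to ι (lookup x (σ i))
  coordinateColouring .consistent x i =
    cong (to ι) (sym (lookup∘updateAt′ (σ i) i (σ-fixedPointFree i) x))

  coordinateColouring-allDistinguished :
    (∀ j → ∃ λ i → σ i ≡ j) → AllDistinguished coordinateColouring
  coordinateColouring-allDistinguished σ-surjective x y Fx≡Fy =
    Pointwise-≡⇒≡ (ext agreeAt)
    where
    agreeAt : ∀ j → lookup x j ≡ lookup y j
    agreeAt j with σ-surjective j
    ... | i , refl = injective ι (begin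
      to ι (lookup x (σ i))                       ≡⟨ lookup∘tabulate (colour coordinateColouring x) i ⟨
      lookup (palette coordinateColouring x) i    ≡⟨ cong (λ v → lookup v i) Fx≡Fy ⟩
      lookup (palette coordinateColouring y) i    ≡⟨ lookup∘tabulate (colour coordinateColouring y) i ⟩
      to ι (lookup y (σ i))                       ∎)
      where open ≡-Reasoning

rotate : ∀ {n} → Fin (suc n) → Fin (suc n)
rotate {n} zero = fromℕ n
rotate (suc i) = inject₁ i

rotate-fixedPointFree : ∀ {n} (i : Fin (suc (suc n))) → rotate i ≢ i
rotate-fixedPointFree zero    ()
rotate-fixedPointFree (suc i) = <⇒≢ (≤̄⇒inject₁< Fin.≤-refl)

rotate-surjective : ∀ {n} (j : Fin (suc n)) → ∃ λ i → rotate i ≡ j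
rotate-surjective {n} j with n ℕ.≟ toℕ j
... | yes n≡j = zero , toℕ-injective (trans (toℕ-fromℕ n) n≡j)
... | no  n≢j = suc (lower₁ j n≢j) , inject₁-lower₁ j n≢j

distinguishable-2 : ∀ n → Distinguishable (suc (suc n)) 2
distinguishable-2 n =
  coordinateColouring ι rotate rotate-fixedPointFree ,
  coordinateColouring-allDistinguished ι rotate rotate-fixedPointFree rotate-surjective
  where
  ι : Bool ↣ Fin 2
  ι = ↔⇒↣ (↔-sym 2↔Bool)

Fin1-unique : (a b : Fin 1) → a ≡ b
Fin1-unique zero zero = refl

palette-unique : ∀ {n} (f : EdgeColouring n 1) x y → palette f x ≡ palette f y
palette-unique f x y = tabulate-cong {f = colour f x} {g = colour f y} (λ i → Fin1-unique _ _)

¬distinguishable-1 : ∀ n → ¬ Distinguishable (suc n) 1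
¬distinguishable-1 n (f , distinguished)
  with distinguished (true ∷ replicate n true) (false ∷ replicate n true) (palette-unique f _ _)
... | ()

distinguishable⇒2≤ : ∀ n k → 1 ≤ k → Distinguishable (suc n) k → 2 ≤ k
distinguishable⇒2≤ n (suc zero)    _ D = contradiction D (¬distinguishable-1 n)
distinguishable⇒2≤ n (suc (suc k)) _ _ = s≤s (s≤s z≤n)

theorem1 : ∀ (n : ℕ) → 2 ≤ n → IsLeastPositive (Distinguishable n) 2
theorem1 (suc (suc n)) (s≤s (s≤s z≤n)) =
  s≤s z≤n , distinguishable-2 n , distinguishable⇒2≤ (suc n)
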